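{- Let $s$ be a positive integer, $L$ a lattice with basis $\mathbf{w}_1,\ldots,\mathbf{w}_n$, and let $\mathbf{u}_1,\ldots,\mathbf{u}_N$ be the pairwise distinct vectors of $L^*$ of norm at most $s$. Then $L$ is $s$-integrable if and only if the system \[ \sum_{k=1}^N(\mathbf{w}_i+\mathbf{w}_j,\mathbf{u}_k)^2x_k=s(\mathbf{w}_i+\mathbf{w}_j,\mathbf{w}_i+\mathbf{w}_j)\qquad(i,j=1,\ldots,n) \] has a solution $(x_1,\ldots,x_N)$ in non-negative integers.
   Context: Lattices are positive definite integral $\mathbb{Z}$-lattices with the standard inner product; the norm of $\mathbf{x}$ is $(\mathbf{x},\mathbf{x})$. The dual is $L^*=\{\mathbf{u}\in L\otimes\mathbb{Q}:(\mathbf{u},\mathbf{v})\in\mathbb{Z}\ \forall\mathbf{v}\in L\}$. $L$ is $s$-integrable if $\sqrt{s}\cdot L$ is isometric to a sublattice of $\mathbb{Z}^m$ for some $m$. -}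

module Defs where

open import Data.Nat as ℕ using (ℕ; zero; suc; NonZero)
open import Data.Integer as ℤ using (ℤ; +_)
open import Data.Rational as ℚ using (ℚ; 0ℚ; 1ℚ; _/_)
open import Data.Fin using (Fin; zero; suc; _≟_)
open import Data.Product using (Σ; ∃; ∃-syntax; _×_; _,_)
open import Relation.Binary.PropositionalEquality using (_≡_; _≢_)
open import Relation.Nullary using (¬_; yes; no)

Σℤ : ∀ {n} → (Fin n → ℤ) → ℤ
Σℤ {zero}  f = + 0
Σℤ {suc n} f = f zero ℤ.+ Σℤ (λ i → f (suc i))

Σℚ : ∀ {n} → (Fin n → ℚ) → ℚ
Σℚ {zero}  f = 0ℚ
Σℚ {suc n} f = f zero ℚ.+ Σℚ (λ i → f (suc i))

ℤ→ℚ : ℤ → ℚ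
ℤ→ℚ z = z / 1

ℕ→ℚ : ℕ → ℚ
ℕ→ℚ k = (+ k) / 1

-- A lattice L of rank n with basis w_1..w_n is given (up to isometry) by its
-- Gram matrix G i j = (w_i , w_j).
Gram : ℕ → Set
Gram n = Fin n → Fin n → ℤ

NonZeroVec : ∀ {n} → (Fin n → ℤ) → Set
NonZeroVec x = ∃[ i ] (x i ≢ + 0)

record IsLattice {n : ℕ} (G : Gram n) : Set where
  field
    symmetric : ∀ i j → G i j ≡ G j i
    posDef    : ∀ (x : Fin n → ℤ) → NonZeroVec x →
                ℤ.+ 0 ℤ.< Σℤ (λ i → Σℤ (λ j → x i ℤ.* G i j ℤ.* x j))

-- Vectors of L ⊗ ℚ, written in coordinates with respect to the basis w_1..w_n.
QVec : ℕ → Set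
QVec n = Fin n → ℚ

inner : ∀ {n} → Gram n → QVec n → QVec n → ℚ
inner G c d = Σℚ (λ i → Σℚ (λ j → c i ℚ.* ℤ→ℚ (G i j) ℚ.* d j))

norm : ∀ {n} → Gram n → QVec n → ℚ
norm G c = inner G c c

basis : ∀ {n} → Fin n → QVec n
basis i j with i ≟ j
... | yes _ = 1ℚ
... | no  _ = 0ℚ

wsum : ∀ {n} → Fin n → Fin n → QVec n
wsum i j k = basis i k ℚ.+ basis j k

-- Membership in the dual lattice L* = { u ∈ L⊗ℚ : (u,v) ∈ ℤ for all v ∈ L }
-- (equivalently for all basis vectors v = w_i, by linearity).
IsInteger : ℚ → Set
IsInteger q = ∃[ z ] (q ≡ ℤ→ℚ z)

InDual : ∀ {n} → Gram n → QVec n → Set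
InDual G u = ∀ i → IsInteger (inner G (basis i) u)

SameVec : ∀ {n} → QVec n → QVec n → Set
SameVec u v = ∀ i → u i ≡ v i

EnumeratesDualBall : ∀ {n} → Gram n → ℕ → (N : ℕ) → (Fin N → QVec n) → Set
EnumeratesDualBall G s N us =
    (∀ k → InDual G (us k) × norm G (us k) ℚ.≤ ℕ→ℚ s)
  × (∀ k l → SameVec (us k) (us l) → k ≡ l)
  × (∀ u → InDual G u → norm G u ℚ.≤ ℕ→ℚ s → ∃[ k ] SameVec (us k) u)

-- L is s-integrable: √s·L is isometric to a sublattice of ℤ^m for some m,
-- i.e. there are v_1..v_n ∈ ℤ^m with v_i·v_j = s (w_i,w_j).
dotℤ : ∀ {m} → (Fin m → ℤ) → (Fin m → ℤ) → ℤ
dotℤ a b = Σℤ (λ k → a k ℤ.* b k)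

Integrable : ∀ {n} → ℕ → Gram n → Set
Integrable {n} s G =
  ∃[ m ] Σ (Fin n → Fin m → ℤ) (λ v → ∀ i j → dotℤ (v i) (v j) ≡ (+ s) ℤ.* G i j)

SystemSolvable : ∀ {n} → Gram n → ℕ → (N : ℕ) → (Fin N → QVec n) → Set
SystemSolvable {n} G s N us =
  Σ (Fin N → ℕ) λ x → ∀ (i j : Fin n) →
    Σℚ (λ k → inner G (wsum i j) (us k) ℚ.* inner G (wsum i j) (us k) ℚ.* ℕ→ℚ (x k))
      ≡ ℕ→ℚ s ℚ.* norm G (wsum i j)

VecList : ℕ → ℕ → Set
VecList N n = Fin N → QVec n

-- If w_i ↦ v_i ∈ ℤ^m realises √s·L, then each coordinate c of the embedding is an
-- integer-valued linear functional on L, i.e. (w_i, a_c) = v_i(c) for a dual vector a_c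
-- (it exists because the Gram matrix is positive definite, hence invertible over ℚ).
-- Summing over coordinates gives Σ_c (y, a_c)² = s (y, y) for every y; for y = a_d this
-- yields (a_d, a_d)² ≤ s (a_d, a_d), so every a_c lies in the dual ball, and counting how
-- often each u_k occurs among the a_c solves the system.  Conversely, with
-- φ_k(i) = (w_i, u_k) ∈ ℤ, the system says that the form Σ_k x_k φ_k(i) φ_k(j) agrees with
-- s (w_i, w_j) on all w_i + w_j, hence everywhere by polarization; repeating each vector
-- φ_k exactly x_k times then realises √s·L inside ℤ^(Σ x_k).

module Submission where

open import Defs
open import Data.Nat as ℕ using (ℕ; NonZero; zero; suc)
open import Function.Bundles using (_⇔_; mk⇔)

open import Algebra.Bundles using (CommutativeRing)
import Algebra.Properties.Monoid.Sum
import Algebra.Properties.Semiring.Sum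
open import Data.Empty using (⊥-elim)
open import Data.Fin using (Fin; zero; suc; _≟_; punchIn; punchOut; splitAt)
import Data.Fin.Properties as Finₚ
open import Data.Integer as ℤ using (ℤ; +_)
import Data.Integer.Properties as ℤP
import Data.Nat.Coprimality as Coprimality
import Data.Nat.Properties as ℕP
open import Data.Product using (Σ-syntax; ∃-syntax; _×_; _,_; proj₁; proj₂)
open import Data.Rational as ℚ using (ℚ; 0ℚ; 1ℚ; _/_; mkℚ; ↥_; ↧_; ↧ₙ_; 1/_)
import Data.Rational.Properties as ℚP
import Data.Rational.Unnormalised as ℚᵘ
import Data.Rational.Unnormalised.Properties as ℚᵘP
open import Data.Rational.Solver using (module +-*-Solver)
open import Data.Sum using (inj₁; inj₂)
open import Data.Vec.Functional using (_++_; replicate; tail)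
open import Function.Base using (_∘_)
open import Relation.Binary.PropositionalEquality
open import Relation.Nullary using (¬?; yes; no)
open import Relation.Nullary.Decidable using (decidable-stable)

open +-*-Solver

module ℕΣ = Algebra.Properties.Monoid.Sum ℕP.+-0-monoid
module ℚΣ = Algebra.Properties.Semiring.Sum (CommutativeRing.semiring ℚP.+-*-commutativeRing)

ℤ→ℚ≡mkℚ : ∀ z → ℤ→ℚ z ≡ mkℚ z 0 (Coprimality.sym (Coprimality.1-coprimeTo _))
ℤ→ℚ≡mkℚ z = ℚP.↥p/↧p≡p (mkℚ z 0 (Coprimality.sym (Coprimality.1-coprimeTo _)))

ℤ→ℚ-+ : ∀ a b → ℤ→ℚ (a ℤ.+ b) ≡ ℤ→ℚ a ℚ.+ ℤ→ℚ b
ℤ→ℚ-+ a b rewrite ℤ→ℚ≡mkℚ a | ℤ→ℚ≡mkℚ b =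
  cong (_/ 1) (cong₂ ℤ._+_ (sym (ℤP.*-identityʳ a)) (sym (ℤP.*-identityʳ b)))

ℤ→ℚ-* : ∀ a b → ℤ→ℚ (a ℤ.* b) ≡ ℤ→ℚ a ℚ.* ℤ→ℚ b
ℤ→ℚ-* a b rewrite ℤ→ℚ≡mkℚ a | ℤ→ℚ≡mkℚ b = refl

ℤ→ℚ-injective : ∀ {a b} → ℤ→ℚ a ≡ ℤ→ℚ b → a ≡ b
ℤ→ℚ-injective {a} {b} eq with trans (sym (ℤ→ℚ≡mkℚ a)) (trans eq (ℤ→ℚ≡mkℚ b))
... | refl = refl

ℤ→ℚ-Σ : ∀ {n} (f : Fin n → ℤ) → ℤ→ℚ (Σℤ f) ≡ Σℚ (ℤ→ℚ ∘ f)
ℤ→ℚ-Σ {zero}  f = refl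
ℤ→ℚ-Σ {suc n} f = trans (ℤ→ℚ-+ (f zero) _) (cong (ℤ→ℚ (f zero) ℚ.+_) (ℤ→ℚ-Σ (f ∘ suc)))

ℕ→ℚ-* : ∀ a b → ℕ→ℚ (a ℕ.* b) ≡ ℕ→ℚ a ℚ.* ℕ→ℚ b
ℕ→ℚ-* a b = trans (cong ℤ→ℚ (ℤP.pos-* a b)) (ℤ→ℚ-* (+ a) (+ b))

↧q*q≡↥q : ∀ q → ℤ→ℚ (↧ q) ℚ.* q ≡ ℤ→ℚ (↥ q)
↧q*q≡↥q q@(mkℚ n d c) rewrite ℤ→ℚ≡mkℚ (+ suc d) | ℤ→ℚ≡mkℚ n =
  ℚP.toℚᵘ-injective (ℚᵘP.≃-trans
    (ℚP.toℚᵘ-homo-* (mkℚ (+ suc d) 0 (Coprimality.sym (Coprimality.1-coprimeTo _))) q)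
    (ℚᵘ.*≡* (trans (ℤP.*-identityʳ _) (trans (ℤP.*-comm (+ suc d) n)
      (cong (λ t → n ℤ.* + suc t) (sym (ℕP.+-identityʳ d)))))))

Σℚ≡sum : ∀ {n} (f : Fin n → ℚ) → Σℚ f ≡ ℚΣ.sum f
Σℚ≡sum {zero}  f = refl
Σℚ≡sum {suc n} f = cong (f zero ℚ.+_) (Σℚ≡sum (f ∘ suc))

Σℚ-cong : ∀ {n} {f g : Fin n → ℚ} → (∀ i → f i ≡ g i) → Σℚ f ≡ Σℚ g
Σℚ-cong {zero}  f≗g = refl
Σℚ-cong {suc n} f≗g = cong₂ ℚ._+_ (f≗g zero) (Σℚ-cong (f≗g ∘ suc))

Σℚ-distrib-+ : ∀ {n} (f g : Fin n → ℚ) → Σℚ (λ i → f i ℚ.+ g i) ≡ Σℚ f ℚ.+ Σℚ g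
Σℚ-distrib-+ f g = begin
  Σℚ (λ i → f i ℚ.+ g i)          ≡⟨ Σℚ≡sum (λ i → f i ℚ.+ g i) ⟩
  ℚΣ.sum (λ i → f i ℚ.+ g i)      ≡⟨ ℚΣ.∑-distrib-+ f g ⟩
  ℚΣ.sum f ℚ.+ ℚΣ.sum g           ≡⟨ cong₂ ℚ._+_ (Σℚ≡sum f) (Σℚ≡sum g) ⟨
  Σℚ f ℚ.+ Σℚ g                   ∎
  where open ≡-Reasoning

*-distribˡ-Σℚ : ∀ {n} c (f : Fin n → ℚ) → c ℚ.* Σℚ f ≡ Σℚ (λ i → c ℚ.* f i)
*-distribˡ-Σℚ c f = begin
  c ℚ.* Σℚ f                ≡⟨ cong (c ℚ.*_) (Σℚ≡sum f) ⟩
  c ℚ.* ℚΣ.sum f            ≡⟨ ℚΣ.*-distribˡ-sum c f ⟩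
  ℚΣ.sum (λ i → c ℚ.* f i)  ≡⟨ Σℚ≡sum (λ i → c ℚ.* f i) ⟨
  Σℚ (λ i → c ℚ.* f i)      ∎
  where open ≡-Reasoning

*-distribʳ-Σℚ : ∀ {n} c (f : Fin n → ℚ) → Σℚ f ℚ.* c ≡ Σℚ (λ i → f i ℚ.* c)
*-distribʳ-Σℚ c f = begin
  Σℚ f ℚ.* c                ≡⟨ cong (ℚ._* c) (Σℚ≡sum f) ⟩
  ℚΣ.sum f ℚ.* c            ≡⟨ ℚΣ.*-distribʳ-sum c f ⟩
  ℚΣ.sum (λ i → f i ℚ.* c)  ≡⟨ Σℚ≡sum (λ i → f i ℚ.* c) ⟨
  Σℚ (λ i → f i ℚ.* c)      ∎
  where open ≡-Reasoning

Σℚ-comm : ∀ {m n} (f : Fin m → Fin n → ℚ) →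
          Σℚ (λ i → Σℚ (λ j → f i j)) ≡ Σℚ (λ j → Σℚ (λ i → f i j))
Σℚ-comm f = begin
  Σℚ (λ i → Σℚ (f i))                 ≡⟨ Σℚ²≡sum² f ⟩
  ℚΣ.sum (λ i → ℚΣ.sum (f i))         ≡⟨ ℚΣ.∑-comm f ⟩
  ℚΣ.sum (λ j → ℚΣ.sum (λ i → f i j)) ≡⟨ Σℚ²≡sum² (λ j i → f i j) ⟨
  Σℚ (λ j → Σℚ (λ i → f i j))         ∎
  where
  open ≡-Reasoning
  Σℚ²≡sum² : ∀ {m n} (g : Fin m → Fin n → ℚ) →
             Σℚ (λ i → Σℚ (g i)) ≡ ℚΣ.sum (λ i → ℚΣ.sum (g i))
  Σℚ²≡sum² g = trans (Σℚ-cong (Σℚ≡sum ∘ g)) (Σℚ≡sum (λ i → ℚΣ.sum (g i)))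

Σℚ²-*ˡ : ∀ {m n} a (f : Fin m → Fin n → ℚ) →
         Σℚ (λ i → Σℚ (λ j → a ℚ.* f i j)) ≡ a ℚ.* Σℚ (λ i → Σℚ (λ j → f i j))
Σℚ²-*ˡ a f = trans (Σℚ-cong (λ i → sym (*-distribˡ-Σℚ a (f i))))
                   (sym (*-distribˡ-Σℚ a (λ i → Σℚ (f i))))

Σℚ-*-Σℚ : ∀ {m n} (f : Fin m → ℚ) (g : Fin n → ℚ) →
          Σℚ f ℚ.* Σℚ g ≡ Σℚ (λ i → Σℚ (λ j → f i ℚ.* g j))
Σℚ-*-Σℚ f g = trans (*-distribʳ-Σℚ (Σℚ g) f) (Σℚ-cong (λ i → *-distribˡ-Σℚ (f i) g))

Σℚ-zero : ∀ n → Σℚ {n} (λ _ → 0ℚ) ≡ 0ℚ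
Σℚ-zero n = trans (Σℚ≡sum {n} (λ _ → 0ℚ)) (ℚΣ.sum-replicate-zero n)

basis-diag : ∀ {n} (i : Fin n) → basis i i ≡ 1ℚ
basis-diag i with i ≟ i
... | yes _  = refl
... | no i≢i = ⊥-elim (i≢i refl)

basis-offdiag : ∀ {n} {i j : Fin n} → i ≢ j → basis i j ≡ 0ℚ
basis-offdiag {i = i} {j} i≢j with i ≟ j
... | yes i≡j = ⊥-elim (i≢j i≡j)
... | no _    = refl

Σℚ-basisˡ : ∀ {n} (i : Fin n) (f : Fin n → ℚ) → Σℚ (λ j → basis i j ℚ.* f j) ≡ f i
Σℚ-basisˡ {suc n} i f = begin
  Σℚ t                                          ≡⟨ Σℚ≡sum t ⟩
  ℚΣ.sum t                                      ≡⟨ ℚΣ.sum-remove {i = i} t ⟩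
  t i ℚ.+ ℚΣ.sum (t ∘ punchIn i)                ≡⟨ cong₂ ℚ._+_ tᵢ≡fᵢ (sym (Σℚ≡sum (t ∘ punchIn i))) ⟩
  f i ℚ.+ Σℚ (t ∘ punchIn i)                    ≡⟨ cong (f i ℚ.+_) (trans (Σℚ-cong t↑≡0) (Σℚ-zero n)) ⟩
  f i ℚ.+ 0ℚ                                    ≡⟨ ℚP.+-identityʳ (f i) ⟩
  f i                                           ∎
  where
  open ≡-Reasoning
  t : Fin (suc n) → ℚ
  t j = basis i j ℚ.* f j
  tᵢ≡fᵢ : t i ≡ f i
  tᵢ≡fᵢ = trans (cong (ℚ._* f i) (basis-diag i)) (ℚP.*-identityˡ (f i))
  t↑≡0 : ∀ j → t (punchIn i j) ≡ 0ℚ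
  t↑≡0 j = trans (cong (ℚ._* f (punchIn i j)) (basis-offdiag (Finₚ.punchInᵢ≢i i j ∘ sym)))
                 (ℚP.*-zeroˡ (f (punchIn i j)))

Σℚ-basisʳ : ∀ {n} (i : Fin n) (f : Fin n → ℚ) → Σℚ (λ j → f j ℚ.* basis i j) ≡ f i
Σℚ-basisʳ i f = trans (Σℚ-cong (λ j → ℚP.*-comm (f j) (basis i j))) (Σℚ-basisˡ i f)

*-cancelˡ-≡ : ∀ k {a b} → k ≢ 0ℚ → k ℚ.* a ≡ k ℚ.* b → a ≡ b
*-cancelˡ-≡ k {a} {b} k≢0 ka≡kb = begin
  a                   ≡⟨ ℚP.*-identityˡ a ⟨
  1ℚ ℚ.* a            ≡⟨ cong (ℚ._* a) (ℚP.*-inverseˡ k) ⟨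
  1/ k ℚ.* k ℚ.* a    ≡⟨ ℚP.*-assoc (1/ k) k a ⟩
  1/ k ℚ.* (k ℚ.* a)  ≡⟨ cong (1/ k ℚ.*_) ka≡kb ⟩
  1/ k ℚ.* (k ℚ.* b)  ≡⟨ ℚP.*-assoc (1/ k) k b ⟨
  1/ k ℚ.* k ℚ.* b    ≡⟨ cong (ℚ._* b) (ℚP.*-inverseˡ k) ⟩
  1ℚ ℚ.* b            ≡⟨ ℚP.*-identityˡ b ⟩
  b                   ∎
  where
  open ≡-Reasoning
  instance
    k-nonZero : ℚ.NonZero k
    k-nonZero = ℚ.≢-nonZero k≢0

Matrix : ℕ → Set
Matrix n = Fin n → Fin n → ℚ

_·_ : ∀ {n} → Matrix n → QVec n → QVec n
(M · x) i = Σℚ (λ j → M i j ℚ.* x j)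

TrivialKernel : ∀ {n} → Matrix n → Set
TrivialKernel {n} M = ∀ (x : QVec n) → (∀ i → (M · x) i ≡ 0ℚ) → ∀ j → x j ≡ 0ℚ

Solvable : ∀ {n} → Matrix n → Set
Solvable {n} M = ∀ (b : QVec n) → ∃[ x ] (∀ i → (M · x) i ≡ b i)

·-basis : ∀ {n} (M : Matrix n) i j → (M · basis j) i ≡ M i j
·-basis M i j = Σℚ-basisʳ j (M i)

·-distrib-+ : ∀ {n} (M : Matrix n) (x y : QVec n) i →
              (M · (λ j → x j ℚ.+ y j)) i ≡ (M · x) i ℚ.+ (M · y) i
·-distrib-+ M x y i = trans (Σℚ-cong (λ j → ℚP.*-distribˡ-+ (M i j) (x j) (y j)))
                            (Σℚ-distrib-+ (λ j → M i j ℚ.* x j) (λ j → M i j ℚ.* y j))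

Σℚ-sub-* : ∀ {n} (f g x : Fin n → ℚ) c →
           Σℚ (λ j → (f j ℚ.- c ℚ.* g j) ℚ.* x j) ≡
           Σℚ (λ j → f j ℚ.* x j) ℚ.- c ℚ.* Σℚ (λ j → g j ℚ.* x j)
Σℚ-sub-* {zero}  f g x c = solve 1 (λ c → con 0ℚ := con 0ℚ :- c :* con 0ℚ) refl c
Σℚ-sub-* {suc n} f g x c rewrite Σℚ-sub-* (f ∘ suc) (g ∘ suc) (x ∘ suc) c =
  solve 6 (λ f₀ g₀ x₀ c Σf Σg → (f₀ :- c :* g₀) :* x₀ :+ (Σf :- c :* Σg)
                              := (f₀ :* x₀ :+ Σf) :- c :* (g₀ :* x₀ :+ Σg))
    refl (f zero) (g zero) (x zero) c
    (Σℚ (λ j → f (suc j) ℚ.* x (suc j))) (Σℚ (λ j → g (suc j) ℚ.* x (suc j)))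

∀-punchIn : ∀ {n p} {P : Fin (suc n) → Set p} r → P r → (∀ i → P (punchIn r i)) → ∀ i → P i
∀-punchIn {P = P} r Pr P↑ i with i ≟ r
... | yes refl = Pr
... | no i≢r   = subst P (Finₚ.punchIn-punchOut (i≢r ∘ sym)) (P↑ (punchOut (i≢r ∘ sym)))

module PivotElimination {n} (M : Matrix (suc n)) (r : Fin (suc n)) (pivot≢0 : M r zero ≢ 0ℚ) where

  instance
    pivot-nonZero : ℚ.NonZero (M r zero)
    pivot-nonZero = ℚ.≢-nonZero pivot≢0

  factor : Fin n → ℚ
  factor i = M (punchIn r i) zero ℚ.* 1/ (M r zero)

  reduced : Matrix n
  reduced i j = M (punchIn r i) (suc j) ℚ.- factor i ℚ.* M r (suc j)

  pivotRowTail : QVec n → ℚ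
  pivotRowTail y = Σℚ (λ j → M r (suc j) ℚ.* y j)

  extend : QVec n → ℚ → QVec (suc n)
  extend y t zero    = 1/ (M r zero) ℚ.* (t ℚ.- pivotRowTail y)
  extend y t (suc j) = y j

  ·-extend-pivot : ∀ y t → (M · extend y t) r ≡ t
  ·-extend-pivot y t = begin
    M r zero ℚ.* (1/ M r zero ℚ.* (t ℚ.- Σy)) ℚ.+ Σy
      ≡⟨ cong (ℚ._+ Σy) (ℚP.*-assoc (M r zero) _ _) ⟨
    M r zero ℚ.* 1/ M r zero ℚ.* (t ℚ.- Σy) ℚ.+ Σy
      ≡⟨ cong (λ a → a ℚ.* (t ℚ.- Σy) ℚ.+ Σy) (ℚP.*-inverseʳ (M r zero)) ⟩
    1ℚ ℚ.* (t ℚ.- Σy) ℚ.+ Σy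
      ≡⟨ solve 2 (λ t Σy → con 1ℚ :* (t :- Σy) :+ Σy := t) refl t Σy ⟩
    t
      ∎
    where
    open ≡-Reasoning
    Σy : ℚ
    Σy = pivotRowTail y

  ·-extend-punchIn : ∀ y t i → (M · extend y t) (punchIn r i) ≡ (reduced · y) i ℚ.+ factor i ℚ.* t
  ·-extend-punchIn y t i = begin
    a ℚ.* (p⁻¹ ℚ.* (t ℚ.- Σy)) ℚ.+ Σa
      ≡⟨ solve 5 (λ a p⁻¹ t Σy Σa → a :* (p⁻¹ :* (t :- Σy)) :+ Σa
                                 := (Σa :- (a :* p⁻¹) :* Σy) :+ (a :* p⁻¹) :* t)
           refl a p⁻¹ t Σy Σa ⟩
    (Σa ℚ.- factor i ℚ.* Σy) ℚ.+ factor i ℚ.* t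
      ≡⟨ cong (ℚ._+ factor i ℚ.* t)
              (Σℚ-sub-* (λ j → M (punchIn r i) (suc j)) (λ j → M r (suc j)) y (factor i)) ⟨
    (reduced · y) i ℚ.+ factor i ℚ.* t
      ∎
    where
    open ≡-Reasoning
    a p⁻¹ Σy Σa : ℚ
    a   = M (punchIn r i) zero
    p⁻¹ = 1/ (M r zero)
    Σy  = pivotRowTail y
    Σa  = Σℚ (λ j → M (punchIn r i) (suc j) ℚ.* y j)

  reduced-trivialKernel : TrivialKernel M → TrivialKernel reduced
  reduced-trivialKernel ker y reduced·y≡0 j = ker (extend y 0ℚ) M·x≡0 (suc j)
    where
    M·x≡0 : ∀ i → (M · extend y 0ℚ) i ≡ 0ℚ
    M·x≡0 = ∀-punchIn r (·-extend-pivot y 0ℚ) λ i →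
      trans (·-extend-punchIn y 0ℚ i)
            (trans (cong₂ ℚ._+_ (reduced·y≡0 i) (ℚP.*-zeroʳ (factor i))) (ℚP.+-identityʳ 0ℚ))

  lift-solution : ∀ (b : QVec (suc n)) y → (∀ i → (reduced · y) i ≡ b (punchIn r i) ℚ.- factor i ℚ.* b r) →
                  ∀ i → (M · extend y (b r)) i ≡ b i
  lift-solution b y hy = ∀-punchIn r (·-extend-pivot y (b r)) λ i →
    trans (·-extend-punchIn y (b r) i)
          (trans (cong (ℚ._+ factor i ℚ.* b r) (hy i))
                 (solve 2 (λ bᵢ c → (bᵢ :- c) :+ c := bᵢ) refl (b (punchIn r i)) (factor i ℚ.* b r)))

trivialKernel⇒solvable : ∀ {n} (M : Matrix n) → TrivialKernel M → Solvable M
trivialKernel⇒solvable {zero}  M ker b = (λ ()) , (λ ())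
trivialKernel⇒solvable {suc n} M ker b with Finₚ.any? (λ r → ¬? (M r zero ℚP.≟ 0ℚ))
... | yes (r , pivot≢0) =
  let open PivotElimination M r pivot≢0
      (y , hy) = trivialKernel⇒solvable reduced (reduced-trivialKernel ker)
                                        (λ i → b (punchIn r i) ℚ.- factor i ℚ.* b r)
  in extend y (b r) , lift-solution b y hy
... | no ¬pivot = ⊥-elim (1≢0 (trans (sym (basis-diag {suc n} zero)) (ker (basis zero) M·e₀≡0 zero)))
  where
  1≢0 : 1ℚ ≢ 0ℚ
  1≢0 ()
  M·e₀≡0 : ∀ i → (M · basis zero) i ≡ 0ℚ
  M·e₀≡0 i = trans (·-basis M i zero)
                   (decidable-stable (M i zero ℚP.≟ 0ℚ) (λ Mᵢ₀≢0 → ¬pivot (i , Mᵢ₀≢0)))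

Gℚ : ∀ {n} → Gram n → Matrix n
Gℚ G i j = ℤ→ℚ (G i j)

inner≡Σ· : ∀ {n} (G : Gram n) c d → inner G c d ≡ Σℚ (λ i → c i ℚ.* (Gℚ G · d) i)
inner≡Σ· G c d = Σℚ-cong λ i →
  trans (Σℚ-cong (λ j → ℚP.*-assoc (c i) (Gℚ G i j) (d j)))
        (sym (*-distribˡ-Σℚ (c i) (λ j → Gℚ G i j ℚ.* d j)))

inner-basisˡ : ∀ {n} (G : Gram n) i d → inner G (basis i) d ≡ (Gℚ G · d) i
inner-basisˡ G i d = trans (inner≡Σ· G (basis i) d) (Σℚ-basisˡ i (Gℚ G · d))

inner-+ˡ : ∀ {n} (G : Gram n) (c c′ d : QVec n) →
           inner G (λ k → c k ℚ.+ c′ k) d ≡ inner G c d ℚ.+ inner G c′ d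
inner-+ˡ {n} G c c′ d = begin
  inner G (λ k → c k ℚ.+ c′ k) d
    ≡⟨ inner≡Σ· G (λ k → c k ℚ.+ c′ k) d ⟩
  Σℚ (λ k → (c k ℚ.+ c′ k) ℚ.* Gd k)
    ≡⟨ Σℚ-cong (λ k → ℚP.*-distribʳ-+ (Gd k) (c k) (c′ k)) ⟩
  Σℚ (λ k → c k ℚ.* Gd k ℚ.+ c′ k ℚ.* Gd k)
    ≡⟨ Σℚ-distrib-+ (λ k → c k ℚ.* Gd k) (λ k → c′ k ℚ.* Gd k) ⟩
  Σℚ (λ k → c k ℚ.* Gd k) ℚ.+ Σℚ (λ k → c′ k ℚ.* Gd k)
    ≡⟨ cong₂ ℚ._+_ (inner≡Σ· G c d) (inner≡Σ· G c′ d) ⟨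
  inner G c d ℚ.+ inner G c′ d
    ∎
  where
  open ≡-Reasoning
  Gd : QVec n
  Gd = Gℚ G · d

inner-congʳ : ∀ {n} (G : Gram n) c {d d′} → SameVec d d′ → inner G c d ≡ inner G c d′
inner-congʳ G c d≡d′ = Σℚ-cong λ i → Σℚ-cong λ j → cong (c i ℚ.* Gℚ G i j ℚ.*_) (d≡d′ j)

norm-wsum : ∀ {n} {G : Gram n} → (∀ i j → G i j ≡ G j i) → ∀ i j →
            norm G (wsum i j) ≡ Gℚ G i i ℚ.+ Gℚ G i j ℚ.+ (Gℚ G i j ℚ.+ Gℚ G j j)
norm-wsum {G = G} symmetric i j = begin
  norm G (wsum i j)
    ≡⟨ inner-+ˡ G (basis i) (basis j) (wsum i j) ⟩
  inner G (basis i) (wsum i j) ℚ.+ inner G (basis j) (wsum i j)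
    ≡⟨ cong₂ ℚ._+_ (inner-basisˡ G i (wsum i j)) (inner-basisˡ G j (wsum i j)) ⟩
  (Gℚ G · wsum i j) i ℚ.+ (Gℚ G · wsum i j) j
    ≡⟨ cong₂ ℚ._+_ (G·wsum i) (G·wsum j) ⟩
  Gℚ G i i ℚ.+ Gℚ G i j ℚ.+ (Gℚ G j i ℚ.+ Gℚ G j j)
    ≡⟨ cong (λ g → Gℚ G i i ℚ.+ Gℚ G i j ℚ.+ (ℤ→ℚ g ℚ.+ Gℚ G j j)) (symmetric j i) ⟩
  Gℚ G i i ℚ.+ Gℚ G i j ℚ.+ (Gℚ G i j ℚ.+ Gℚ G j j)
    ∎
  where
  open ≡-Reasoning
  G·wsum : ∀ k → (Gℚ G · wsum i j) k ≡ Gℚ G k i ℚ.+ Gℚ G k j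
  G·wsum k = trans (·-distrib-+ (Gℚ G) (basis i) (basis j) k)
                   (cong₂ ℚ._+_ (·-basis (Gℚ G) k i) (·-basis (Gℚ G) k j))

norm-*ˡ : ∀ {n} (G : Gram n) a x → norm G (λ i → a ℚ.* x i) ≡ a ℚ.* a ℚ.* norm G x
norm-*ˡ G a x = trans (Σℚ-cong λ i → Σℚ-cong λ j →
                         solve 4 (λ a xᵢ g xⱼ → a :* xᵢ :* g :* (a :* xⱼ) := a :* a :* (xᵢ :* g :* xⱼ))
                           refl a (x i) (Gℚ G i j) (x j))
                      (Σℚ²-*ˡ (a ℚ.* a) (λ i j → x i ℚ.* Gℚ G i j ℚ.* x j))

norm≡0 : ∀ {n} (G : Gram n) x → (∀ i → (Gℚ G · x) i ≡ 0ℚ) → norm G x ≡ 0ℚ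
norm≡0 {n} G x Gx≡0 = trans (inner≡Σ· G x x) (trans (Σℚ-cong xᵢ*0≡0) (Σℚ-zero n))
  where
  xᵢ*0≡0 : ∀ i → x i ℚ.* (Gℚ G · x) i ≡ 0ℚ
  xᵢ*0≡0 i = trans (cong (x i ℚ.*_) (Gx≡0 i)) (ℚP.*-zeroʳ (x i))

ℤ→ℚ-quadraticForm : ∀ {n} (G : Gram n) (z : Fin n → ℤ) →
                    ℤ→ℚ (Σℤ (λ i → Σℤ (λ j → z i ℤ.* G i j ℤ.* z j))) ≡ norm G (ℤ→ℚ ∘ z)
ℤ→ℚ-quadraticForm G z =
  trans (ℤ→ℚ-Σ (λ i → Σℤ (λ j → z i ℤ.* G i j ℤ.* z j))) (Σℚ-cong λ i →
  trans (ℤ→ℚ-Σ (λ j → z i ℤ.* G i j ℤ.* z j)) (Σℚ-cong λ j →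
    trans (ℤ→ℚ-* (z i ℤ.* G i j) (z j)) (cong (ℚ._* ℤ→ℚ (z j)) (ℤ→ℚ-* (z i) (G i j)))))

clearDenominators : ∀ {n} (x : QVec n) →
                    Σ[ D ∈ ℕ ] NonZero D × Σ[ z ∈ (Fin n → ℤ) ] (∀ i → ℤ→ℚ (z i) ≡ ℕ→ℚ D ℚ.* x i)
clearDenominators {zero}  x = 1 , _ , (λ ()) , (λ ())
clearDenominators {suc n} x with clearDenominators (x ∘ suc)
... | D , D≢0 , z , z≡Dx = d ℕ.* D , ℕP.m*n≢0 d D {{_}} {{D≢0}} , z′ , z′≡dDx
  where
  d : ℕ
  d = ↧ₙ (x zero)
  z′ : Fin (suc n) → ℤ
  z′ zero    = ↥ (x zero) ℤ.* + D
  z′ (suc i) = + d ℤ.* z i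
  z′≡dDx : ∀ i → ℤ→ℚ (z′ i) ≡ ℕ→ℚ (d ℕ.* D) ℚ.* x i
  z′≡dDx zero = begin
    ℤ→ℚ (↥ (x zero) ℤ.* + D)
      ≡⟨ ℤ→ℚ-* (↥ (x zero)) (+ D) ⟩
    ℤ→ℚ (↥ (x zero)) ℚ.* ℕ→ℚ D
      ≡⟨ cong (ℚ._* ℕ→ℚ D) (↧q*q≡↥q (x zero)) ⟨
    ℕ→ℚ d ℚ.* x zero ℚ.* ℕ→ℚ D
      ≡⟨ solve 3 (λ d x D → d :* x :* D := d :* D :* x) refl (ℕ→ℚ d) (x zero) (ℕ→ℚ D) ⟩
    ℕ→ℚ d ℚ.* ℕ→ℚ D ℚ.* x zero
      ≡⟨ cong (ℚ._* x zero) (ℕ→ℚ-* d D) ⟨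
    ℕ→ℚ (d ℕ.* D) ℚ.* x zero
      ∎
    where open ≡-Reasoning
  z′≡dDx (suc i) = begin
    ℤ→ℚ (+ d ℤ.* z i)                        ≡⟨ ℤ→ℚ-* (+ d) (z i) ⟩
    ℕ→ℚ d ℚ.* ℤ→ℚ (z i)                      ≡⟨ cong (ℕ→ℚ d ℚ.*_) (z≡Dx i) ⟩
    ℕ→ℚ d ℚ.* (ℕ→ℚ D ℚ.* x (suc i))          ≡⟨ ℚP.*-assoc (ℕ→ℚ d) (ℕ→ℚ D) (x (suc i)) ⟨
    ℕ→ℚ d ℚ.* ℕ→ℚ D ℚ.* x (suc i)            ≡⟨ cong (ℚ._* x (suc i)) (ℕ→ℚ-* d D) ⟨
    ℕ→ℚ (d ℕ.* D) ℚ.* x (suc i)              ∎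
    where open ≡-Reasoning

posDef⇒trivialKernel : ∀ {n} {G : Gram n} → IsLattice G → TrivialKernel (Gℚ G)
posDef⇒trivialKernel {G = G} lat x Gx≡0 j with x j ℚP.≟ 0ℚ
... | yes xⱼ≡0 = xⱼ≡0
... | no  xⱼ≢0 with clearDenominators x
...   | D , D≢0 , z , z≡Dx = ⊥-elim (ℤP.<-irrefl (sym Qz≡0) (IsLattice.posDef lat z (j , zⱼ≢0)))
  where
  D≢0ℚ : ℕ→ℚ D ≢ 0ℚ
  D≢0ℚ D≡0 = ℕ.≢-nonZero⁻¹ D {{D≢0}} (ℤP.+-injective (ℤ→ℚ-injective D≡0))
  zⱼ≢0 : z j ≢ + 0
  zⱼ≢0 zⱼ≡0 = xⱼ≢0 (*-cancelˡ-≡ (ℕ→ℚ D) D≢0ℚ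
    (trans (sym (z≡Dx j)) (trans (cong ℤ→ℚ zⱼ≡0) (sym (ℚP.*-zeroʳ (ℕ→ℚ D))))))
  Qz≡0 : Σℤ (λ i → Σℤ (λ k → z i ℤ.* G i k ℤ.* z k)) ≡ + 0
  Qz≡0 = ℤ→ℚ-injective (begin
    ℤ→ℚ (Σℤ (λ i → Σℤ (λ k → z i ℤ.* G i k ℤ.* z k)))
      ≡⟨ ℤ→ℚ-quadraticForm G z ⟩
    norm G (ℤ→ℚ ∘ z)
      ≡⟨ Σℚ-cong (λ i → Σℚ-cong (λ k → cong₂ (λ a b → a ℚ.* Gℚ G i k ℚ.* b) (z≡Dx i) (z≡Dx k))) ⟩
    norm G (λ i → ℕ→ℚ D ℚ.* x i)
      ≡⟨ norm-*ˡ G (ℕ→ℚ D) x ⟩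
    ℕ→ℚ D ℚ.* ℕ→ℚ D ℚ.* norm G x
      ≡⟨ cong (ℕ→ℚ D ℚ.* ℕ→ℚ D ℚ.*_) (norm≡0 G x Gx≡0) ⟩
    ℕ→ℚ D ℚ.* ℕ→ℚ D ℚ.* 0ℚ
      ≡⟨ ℚP.*-zeroʳ (ℕ→ℚ D ℚ.* ℕ→ℚ D) ⟩
    0ℚ
      ∎)
    where open ≡-Reasoning

Σℚ-square-linearForm : ∀ {m n} (V : Fin n → Fin m → ℚ) (y : Fin n → ℚ) →
  Σℚ (λ c → Σℚ (λ i → y i ℚ.* V i c) ℚ.* Σℚ (λ j → y j ℚ.* V j c))
    ≡ Σℚ (λ i → Σℚ (λ j → y i ℚ.* Σℚ (λ c → V i c ℚ.* V j c) ℚ.* y j))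
Σℚ-square-linearForm {m} {n} V y = begin
  Σℚ (λ c → Σℚ (λ i → y i ℚ.* V i c) ℚ.* Σℚ (λ j → y j ℚ.* V j c))
    ≡⟨ Σℚ-cong (λ c → Σℚ-*-Σℚ (λ i → y i ℚ.* V i c) (λ j → y j ℚ.* V j c)) ⟩
  Σℚ (λ c → Σℚ (λ i → Σℚ (λ j → t i j c)))
    ≡⟨ Σℚ-comm (λ c i → Σℚ (λ j → t i j c)) ⟩
  Σℚ (λ i → Σℚ (λ c → Σℚ (λ j → t i j c)))
    ≡⟨ Σℚ-cong (λ i → Σℚ-comm (λ c j → t i j c)) ⟩
  Σℚ (λ i → Σℚ (λ j → Σℚ (λ c → t i j c)))
    ≡⟨ Σℚ-cong (λ i → Σℚ-cong (λ j → trans (Σℚ-cong (λ c → regroup (y i) (V i c) (y j) (V j c)))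
                                              (sym (*-distribʳ-Σℚ (y j) (λ c → y i ℚ.* (V i c ℚ.* V j c)))))) ⟩
  Σℚ (λ i → Σℚ (λ j → Σℚ (λ c → y i ℚ.* (V i c ℚ.* V j c)) ℚ.* y j))
    ≡⟨ Σℚ-cong (λ i → Σℚ-cong (λ j → cong (ℚ._* y j) (sym (*-distribˡ-Σℚ (y i) (λ c → V i c ℚ.* V j c))))) ⟩
  Σℚ (λ i → Σℚ (λ j → y i ℚ.* Σℚ (λ c → V i c ℚ.* V j c) ℚ.* y j))
    ∎
  where
  open ≡-Reasoning
  t : Fin n → Fin n → Fin m → ℚ
  t i j c = y i ℚ.* V i c ℚ.* (y j ℚ.* V j c)
  regroup : ∀ a b c d → a ℚ.* b ℚ.* (c ℚ.* d) ≡ a ℚ.* (b ℚ.* d) ℚ.* c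
  regroup = solve 4 (λ a b c d → a :* b :* (c :* d) := a :* (b :* d) :* c) refl

square-nonNeg : ∀ q → 0ℚ ℚ.≤ q ℚ.* q
square-nonNeg q with ℚP.≤-total 0ℚ q
... | inj₁ 0≤q = ℚP.nonNegative⁻¹ _ {{ℚP.nonNeg*nonNeg⇒nonNeg q q}}
  where
  instance
    q-nonNeg : ℚ.NonNegative q
    q-nonNeg = ℚ.nonNegative 0≤q
-- Despite its name, ℚP.nonPos*nonPos⇒nonPos concludes NonNegative (p * q).
... | inj₂ q≤0 = ℚP.nonNegative⁻¹ _ {{ℚP.nonPos*nonPos⇒nonPos q q}}
  where
  instance
    q-nonPos : ℚ.NonPositive q
    q-nonPos = ℚ.nonPositive q≤0

Σℚ-squares-nonNeg : ∀ {m} (f : Fin m → ℚ) → 0ℚ ℚ.≤ Σℚ (λ c → f c ℚ.* f c)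
Σℚ-squares-nonNeg {zero}  f = ℚP.≤-refl
Σℚ-squares-nonNeg {suc m} f = ℚP.+-mono-≤ (square-nonNeg (f zero)) (Σℚ-squares-nonNeg (f ∘ suc))

square≤Σℚ-squares : ∀ {m} (f : Fin m → ℚ) d → f d ℚ.* f d ℚ.≤ Σℚ (λ c → f c ℚ.* f c)
square≤Σℚ-squares {suc m} f zero = begin
  f zero ℚ.* f zero
    ≡⟨ ℚP.+-identityʳ (f zero ℚ.* f zero) ⟨
  f zero ℚ.* f zero ℚ.+ 0ℚ
    ≤⟨ ℚP.+-monoʳ-≤ (f zero ℚ.* f zero) (Σℚ-squares-nonNeg (f ∘ suc)) ⟩
  f zero ℚ.* f zero ℚ.+ Σℚ (λ c → f (suc c) ℚ.* f (suc c))
    ∎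
  where open ℚP.≤-Reasoning
square≤Σℚ-squares {suc m} f (suc d) = begin
  f (suc d) ℚ.* f (suc d)
    ≡⟨ ℚP.+-identityˡ (f (suc d) ℚ.* f (suc d)) ⟨
  0ℚ ℚ.+ f (suc d) ℚ.* f (suc d)
    ≤⟨ ℚP.+-mono-≤ (square-nonNeg (f zero)) (square≤Σℚ-squares (f ∘ suc) d) ⟩
  f zero ℚ.* f zero ℚ.+ Σℚ (λ c → f (suc c) ℚ.* f (suc c))
    ∎
  where open ℚP.≤-Reasoning

≤-cancel-*-self : ∀ {q s} → 0ℚ ℚ.≤ s → q ℚ.* q ℚ.≤ s ℚ.* q → q ℚ.≤ s
≤-cancel-*-self {q} {s} 0≤s q²≤sq with ℚP.≤-total q 0ℚ
... | inj₁ q≤0 = ℚP.≤-trans q≤0 0≤s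
... | inj₂ 0≤q with q ℚP.≟ 0ℚ
...   | yes refl = 0≤s
...   | no  q≢0  = ℚP.*-cancelʳ-≤-pos q {{q-positive}} q²≤sq
  where
  q-positive : ℚ.Positive q
  q-positive = ℚP.nonNeg∧nonZero⇒pos q {{ℚ.nonNegative 0≤q}} {{ℚ.≢-nonZero q≢0}}

multiplicity : ∀ {m N} → (Fin m → Fin N) → Fin N → ℕ
multiplicity {zero}  f k = 0
multiplicity {suc m} f k with f zero ≟ k
... | yes _ = suc (multiplicity (f ∘ suc) k)
... | no  _ = multiplicity (f ∘ suc) k

ℕ→ℚ-multiplicity : ∀ {m N} (f : Fin m → Fin N) k → ℕ→ℚ (multiplicity f k) ≡ Σℚ (λ c → basis (f c) k)
ℕ→ℚ-multiplicity {zero}  f k = refl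
ℕ→ℚ-multiplicity {suc m} f k with f zero ≟ k
... | yes _ = trans (ℤ→ℚ-+ (+ 1) (+ multiplicity (f ∘ suc) k)) (cong (1ℚ ℚ.+_) (ℕ→ℚ-multiplicity (f ∘ suc) k))
... | no  _ = trans (ℕ→ℚ-multiplicity (f ∘ suc) k) (sym (ℚP.+-identityˡ _))

Σℚ-multiplicity : ∀ {m N} (f : Fin m → Fin N) (h : Fin N → ℚ) →
                  Σℚ (λ k → h k ℚ.* ℕ→ℚ (multiplicity f k)) ≡ Σℚ (λ c → h (f c))
Σℚ-multiplicity f h = begin
  Σℚ (λ k → h k ℚ.* ℕ→ℚ (multiplicity f k))
    ≡⟨ Σℚ-cong (λ k → cong (h k ℚ.*_) (ℕ→ℚ-multiplicity f k)) ⟩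
  Σℚ (λ k → h k ℚ.* Σℚ (λ c → basis (f c) k))
    ≡⟨ Σℚ-cong (λ k → *-distribˡ-Σℚ (h k) (λ c → basis (f c) k)) ⟩
  Σℚ (λ k → Σℚ (λ c → h k ℚ.* basis (f c) k))
    ≡⟨ Σℚ-comm (λ k c → h k ℚ.* basis (f c) k) ⟩
  Σℚ (λ c → Σℚ (λ k → h k ℚ.* basis (f c) k))
    ≡⟨ Σℚ-cong (λ c → Σℚ-basisʳ (f c) h) ⟩
  Σℚ (λ c → h (f c))
    ∎
  where open ≡-Reasoning

module Integrable⇒Solvable {n} (s : ℕ) {G : Gram n} (lat : IsLattice G) {m} (v : Fin n → Fin m → ℤ)
                           (v·v≡sG : ∀ i j → dotℤ (v i) (v j) ≡ (+ s) ℤ.* G i j) where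

  V : Fin n → Fin m → ℚ
  V i c = ℤ→ℚ (v i c)

  private
    coordinateFunctional : ∀ c → ∃[ a ] (∀ i → (Gℚ G · a) i ≡ V i c)
    coordinateFunctional c = trivialKernel⇒solvable (Gℚ G) (posDef⇒trivialKernel lat) (λ i → V i c)

  dualVec : Fin m → QVec n
  dualVec c = proj₁ (coordinateFunctional c)

  inner-dualVec : ∀ y c → inner G y (dualVec c) ≡ Σℚ (λ i → y i ℚ.* V i c)
  inner-dualVec y c = trans (inner≡Σ· G y (dualVec c))
                            (Σℚ-cong (λ i → cong (y i ℚ.*_) (proj₂ (coordinateFunctional c) i)))

  dualVec∈L* : ∀ c → InDual G (dualVec c)
  dualVec∈L* c i = v i c , trans (inner-basisˡ G i (dualVec c)) (proj₂ (coordinateFunctional c) i)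

  V·V≡sG : ∀ i j → Σℚ (λ c → V i c ℚ.* V j c) ≡ ℕ→ℚ s ℚ.* Gℚ G i j
  V·V≡sG i j = begin
    Σℚ (λ c → V i c ℚ.* V j c)         ≡⟨ Σℚ-cong (λ c → ℤ→ℚ-* (v i c) (v j c)) ⟨
    Σℚ (λ c → ℤ→ℚ (v i c ℤ.* v j c))   ≡⟨ ℤ→ℚ-Σ (λ c → v i c ℤ.* v j c) ⟨
    ℤ→ℚ (dotℤ (v i) (v j))             ≡⟨ cong ℤ→ℚ (v·v≡sG i j) ⟩
    ℤ→ℚ (+ s ℤ.* G i j)                ≡⟨ ℤ→ℚ-* (+ s) (G i j) ⟩
    ℕ→ℚ s ℚ.* Gℚ G i j                 ∎
    where open ≡-Reasoning

  inner² : QVec n → QVec n → ℚ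
  inner² y u = inner G y u ℚ.* inner G y u

  Σ-inner²-dualVec : ∀ y → Σℚ (λ c → inner² y (dualVec c)) ≡ ℕ→ℚ s ℚ.* norm G y
  Σ-inner²-dualVec y = begin
    Σℚ (λ c → inner² y (dualVec c))
      ≡⟨ Σℚ-cong (λ c → cong₂ ℚ._*_ (inner-dualVec y c) (inner-dualVec y c)) ⟩
    Σℚ (λ c → Σℚ (λ i → y i ℚ.* V i c) ℚ.* Σℚ (λ j → y j ℚ.* V j c))
      ≡⟨ Σℚ-square-linearForm V y ⟩
    Σℚ (λ i → Σℚ (λ j → y i ℚ.* Σℚ (λ c → V i c ℚ.* V j c) ℚ.* y j))
      ≡⟨ Σℚ-cong (λ i → Σℚ-cong (λ j → trans (cong (λ a → y i ℚ.* a ℚ.* y j) (V·V≡sG i j))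
           (solve 4 (λ yᵢ s g yⱼ → yᵢ :* (s :* g) :* yⱼ := s :* (yᵢ :* g :* yⱼ))
                  refl (y i) (ℕ→ℚ s) (Gℚ G i j) (y j)))) ⟩
    Σℚ (λ i → Σℚ (λ j → ℕ→ℚ s ℚ.* (y i ℚ.* Gℚ G i j ℚ.* y j)))
      ≡⟨ Σℚ²-*ˡ (ℕ→ℚ s) (λ i j → y i ℚ.* Gℚ G i j ℚ.* y j) ⟩
    ℕ→ℚ s ℚ.* norm G y
      ∎
    where open ≡-Reasoning

  norm-dualVec≤s : ∀ c → norm G (dualVec c) ℚ.≤ ℕ→ℚ s
  norm-dualVec≤s c = ≤-cancel-*-self (ℚP.nonNegative⁻¹ (ℕ→ℚ s) {{ℚP.normalize-nonNeg s 1}})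
    (subst (norm G (dualVec c) ℚ.* norm G (dualVec c) ℚ.≤_) (Σ-inner²-dualVec (dualVec c))
           (square≤Σℚ-squares (λ d → inner G (dualVec c) (dualVec d)) c))

  solvable : ∀ {N} (us : VecList N n) → EnumeratesDualBall G s N us → SystemSolvable G s N us
  solvable {N} us (_ , _ , covers) = multiplicity index , λ i j → begin
    Σℚ (λ k → inner² (wsum i j) (us k) ℚ.* ℕ→ℚ (multiplicity index k))
      ≡⟨ Σℚ-multiplicity index (inner² (wsum i j) ∘ us) ⟩
    Σℚ (λ c → inner² (wsum i j) (us (index c)))
      ≡⟨ Σℚ-cong (λ c → cong₂ ℚ._*_ (inner-congʳ G (wsum i j) (index≡ c))
                                    (inner-congʳ G (wsum i j) (index≡ c))) ⟩
    Σℚ (λ c → inner² (wsum i j) (dualVec c))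
      ≡⟨ Σ-inner²-dualVec (wsum i j) ⟩
    ℕ→ℚ s ℚ.* norm G (wsum i j)
      ∎
    where
    open ≡-Reasoning
    match : ∀ c → ∃[ k ] SameVec (us k) (dualVec c)
    match c = covers (dualVec c) (dualVec∈L* c) (norm-dualVec≤s c)
    index : Fin m → Fin N
    index c = proj₁ (match c)
    index≡ : ∀ c → SameVec (us (index c)) (dualVec c)
    index≡ c = proj₂ (match c)

polarization : ∀ {n} (P Q : Matrix n) →
               (∀ i j → P i i ℚ.+ (P i j ℚ.+ P i j) ℚ.+ P j j ≡ Q i i ℚ.+ (Q i j ℚ.+ Q i j) ℚ.+ Q j j) →
               ∀ i j → P i j ≡ Q i j
polarization P Q hyp i j = *-cancelˡ-≡ two (λ ()) (begin
  two ℚ.* P i j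
    ≡⟨ solve 3 (λ a b c → con two :* b := a :+ (b :+ b) :+ c :- a :- c) refl (P i i) (P i j) (P j j) ⟩
  P i i ℚ.+ (P i j ℚ.+ P i j) ℚ.+ P j j ℚ.- P i i ℚ.- P j j
    ≡⟨ cong₂ ℚ._-_ (cong₂ ℚ._-_ (hyp i j) (diagonal i)) (diagonal j) ⟩
  Q i i ℚ.+ (Q i j ℚ.+ Q i j) ℚ.+ Q j j ℚ.- Q i i ℚ.- Q j j
    ≡⟨ solve 3 (λ a b c → a :+ (b :+ b) :+ c :- a :- c := con two :* b) refl (Q i i) (Q i j) (Q j j) ⟩
  two ℚ.* Q i j
    ∎)
  where
  open ≡-Reasoning
  two four : ℚ
  two  = 1ℚ ℚ.+ 1ℚ
  four = two ℚ.+ two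
  diagonal : ∀ i → P i i ≡ Q i i
  diagonal i = *-cancelˡ-≡ four (λ ()) (begin
    four ℚ.* P i i                       ≡⟨ solve 1 (λ p → con four :* p := p :+ (p :+ p) :+ p) refl (P i i) ⟩
    P i i ℚ.+ (P i i ℚ.+ P i i) ℚ.+ P i i ≡⟨ hyp i i ⟩
    Q i i ℚ.+ (Q i i ℚ.+ Q i i) ℚ.+ Q i i ≡⟨ solve 1 (λ q → q :+ (q :+ q) :+ q := con four :* q) refl (Q i i) ⟩
    four ℚ.* Q i i                       ∎)

Σℤ-cong : ∀ {n} {f g : Fin n → ℤ} → (∀ i → f i ≡ g i) → Σℤ f ≡ Σℤ g
Σℤ-cong {zero}  f≗g = refl
Σℤ-cong {suc n} f≗g = cong₂ ℤ._+_ (f≗g zero) (Σℤ-cong (f≗g ∘ suc))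

Σℤ-const : ∀ a c → Σℤ {a} (λ _ → c) ≡ + a ℤ.* c
Σℤ-const zero    c = sym (ℤP.*-zeroˡ c)
Σℤ-const (suc a) c = begin
  c ℤ.+ Σℤ {a} (λ _ → c)   ≡⟨ cong₂ ℤ._+_ (ℤP.*-identityˡ c) (sym (Σℤ-const a c)) ⟨
  + 1 ℤ.* c ℤ.+ + a ℤ.* c  ≡⟨ ℤP.*-distribʳ-+ c (+ 1) (+ a) ⟨
  + suc a ℤ.* c            ∎
  where open ≡-Reasoning

lookup-++-suc : ∀ {a b} {A : Set} (f : Fin (suc a) → A) (g : Fin b → A) i →
                (f ++ g) (suc i) ≡ (tail f ++ g) i
lookup-++-suc {a} f g i with splitAt a i
... | inj₁ _ = refl
... | inj₂ _ = refl

dotℤ-++ : ∀ {a b} (f f′ : Fin a → ℤ) (g g′ : Fin b → ℤ) →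
          dotℤ (f ++ g) (f′ ++ g′) ≡ dotℤ f f′ ℤ.+ dotℤ g g′
dotℤ-++ {zero}  f f′ g g′ = sym (ℤP.+-identityˡ (dotℤ g g′))
dotℤ-++ {suc a} f f′ g g′ = begin
  f zero ℤ.* f′ zero ℤ.+ dotℤ (λ i → (f ++ g) (suc i)) (λ i → (f′ ++ g′) (suc i))
    ≡⟨ cong (ℤ._+_ (f zero ℤ.* f′ zero))
            (Σℤ-cong (λ i → cong₂ ℤ._*_ (lookup-++-suc f g i) (lookup-++-suc f′ g′ i))) ⟩
  f zero ℤ.* f′ zero ℤ.+ dotℤ (tail f ++ g) (tail f′ ++ g′)
    ≡⟨ cong (ℤ._+_ (f zero ℤ.* f′ zero)) (dotℤ-++ (tail f) (tail f′) g g′) ⟩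
  f zero ℤ.* f′ zero ℤ.+ (dotℤ (tail f) (tail f′) ℤ.+ dotℤ g g′)
    ≡⟨ ℤP.+-assoc (f zero ℤ.* f′ zero) _ _ ⟨
  dotℤ f f′ ℤ.+ dotℤ g g′
    ∎
  where open ≡-Reasoning

replicateEach : ∀ {N} (x : Fin N → ℕ) → (Fin N → ℤ) → Fin (ℕΣ.sum x) → ℤ
replicateEach {zero}  x g ()
replicateEach {suc N} x g = replicate (x zero) (g zero) ++ replicateEach (tail x) (tail g)

dotℤ-replicateEach : ∀ {N} (x : Fin N → ℕ) (g g′ : Fin N → ℤ) →
                     dotℤ (replicateEach x g) (replicateEach x g′) ≡ Σℤ (λ k → + x k ℤ.* (g k ℤ.* g′ k))
dotℤ-replicateEach {zero}  x g g′ = refl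
dotℤ-replicateEach {suc N} x g g′ =
  trans (dotℤ-++ (replicate (x zero) (g zero)) (replicate (x zero) (g′ zero)) _ _)
        (cong₂ ℤ._+_ (Σℤ-const (x zero) (g zero ℤ.* g′ zero))
                     (dotℤ-replicateEach (tail x) (tail g) (tail g′)))

module Solvable⇒Integrable {n} (s : ℕ) {G : Gram n} (lat : IsLattice G) {N} (us : VecList N n)
                           (us∈L* : ∀ k → InDual G (us k)) (sol : SystemSolvable G s N us) where

  x : Fin N → ℕ
  x = proj₁ sol

  φ : Fin N → Fin n → ℤ
  φ k i = proj₁ (us∈L* k i)

  Φ : Fin N → Fin n → ℚ
  Φ k i = ℤ→ℚ (φ k i)

  P : Matrix n
  P i j = Σℚ (λ k → Φ k i ℚ.* Φ k j ℚ.* ℕ→ℚ (x k))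

  sG : Matrix n
  sG i j = ℕ→ℚ s ℚ.* Gℚ G i j

  inner-wsum : ∀ i j k → inner G (wsum i j) (us k) ≡ Φ k i ℚ.+ Φ k j
  inner-wsum i j k = trans (inner-+ˡ G (basis i) (basis j) (us k))
                           (cong₂ ℚ._+_ (proj₂ (us∈L* k i)) (proj₂ (us∈L* k j)))

  P-polarized : ∀ i j → P i i ℚ.+ (P i j ℚ.+ P i j) ℚ.+ P j j ≡
                        sG i i ℚ.+ (sG i j ℚ.+ sG i j) ℚ.+ sG j j
  P-polarized i j = begin
    P i i ℚ.+ (P i j ℚ.+ P i j) ℚ.+ P j j
      ≡⟨ cong (λ a → a ℚ.+ P j j) (cong (P i i ℚ.+_) (Σℚ-distrib-+ (t i j) (t i j))) ⟨
    P i i ℚ.+ Σℚ (λ k → t i j k ℚ.+ t i j k) ℚ.+ P j j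
      ≡⟨ cong (ℚ._+ P j j) (Σℚ-distrib-+ (t i i) (λ k → t i j k ℚ.+ t i j k)) ⟨
    Σℚ (λ k → t i i k ℚ.+ (t i j k ℚ.+ t i j k)) ℚ.+ P j j
      ≡⟨ Σℚ-distrib-+ (λ k → t i i k ℚ.+ (t i j k ℚ.+ t i j k)) (t j j) ⟨
    Σℚ (λ k → t i i k ℚ.+ (t i j k ℚ.+ t i j k) ℚ.+ t j j k)
      ≡⟨ Σℚ-cong (λ k → trans (solve 3 (λ a b X → a :* a :* X :+ (a :* b :* X :+ a :* b :* X) :+ b :* b :* X
                                                 := (a :+ b) :* (a :+ b) :* X) refl (Φ k i) (Φ k j) (ℕ→ℚ (x k)))
                                (sym (cong (λ a → a ℚ.* a ℚ.* ℕ→ℚ (x k)) (inner-wsum i j k)))) ⟩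
    Σℚ (λ k → inner G (wsum i j) (us k) ℚ.* inner G (wsum i j) (us k) ℚ.* ℕ→ℚ (x k))
      ≡⟨ proj₂ sol i j ⟩
    ℕ→ℚ s ℚ.* norm G (wsum i j)
      ≡⟨ cong (ℕ→ℚ s ℚ.*_) (norm-wsum (IsLattice.symmetric lat) i j) ⟩
    ℕ→ℚ s ℚ.* (Gℚ G i i ℚ.+ Gℚ G i j ℚ.+ (Gℚ G i j ℚ.+ Gℚ G j j))
      ≡⟨ solve 4 (λ s a b c → s :* (a :+ b :+ (b :+ c)) := s :* a :+ (s :* b :+ s :* b) :+ s :* c)
           refl (ℕ→ℚ s) (Gℚ G i i) (Gℚ G i j) (Gℚ G j j) ⟩
    sG i i ℚ.+ (sG i j ℚ.+ sG i j) ℚ.+ sG j j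
      ∎
    where
    open ≡-Reasoning
    t : Fin n → Fin n → Fin N → ℚ
    t i j k = Φ k i ℚ.* Φ k j ℚ.* ℕ→ℚ (x k)

  v : Fin n → Fin (ℕΣ.sum x) → ℤ
  v i = replicateEach x (λ k → φ k i)

  v·v≡sG : ∀ i j → dotℤ (v i) (v j) ≡ + s ℤ.* G i j
  v·v≡sG i j = ℤ→ℚ-injective (begin
    ℤ→ℚ (dotℤ (v i) (v j))
      ≡⟨ cong ℤ→ℚ (dotℤ-replicateEach x (λ k → φ k i) (λ k → φ k j)) ⟩
    ℤ→ℚ (Σℤ (λ k → + x k ℤ.* (φ k i ℤ.* φ k j)))
      ≡⟨ ℤ→ℚ-Σ (λ k → + x k ℤ.* (φ k i ℤ.* φ k j)) ⟩
    Σℚ (λ k → ℤ→ℚ (+ x k ℤ.* (φ k i ℤ.* φ k j)))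
      ≡⟨ Σℚ-cong ℤ→ℚ-term ⟩
    P i j
      ≡⟨ polarization P sG P-polarized i j ⟩
    ℕ→ℚ s ℚ.* Gℚ G i j
      ≡⟨ ℤ→ℚ-* (+ s) (G i j) ⟨
    ℤ→ℚ (+ s ℤ.* G i j)
      ∎)
    where
    open ≡-Reasoning
    ℤ→ℚ-term : ∀ k → ℤ→ℚ (+ x k ℤ.* (φ k i ℤ.* φ k j)) ≡ Φ k i ℚ.* Φ k j ℚ.* ℕ→ℚ (x k)
    ℤ→ℚ-term k = trans (ℤ→ℚ-* (+ x k) (φ k i ℤ.* φ k j))
                       (trans (cong (ℕ→ℚ (x k) ℚ.*_) (ℤ→ℚ-* (φ k i) (φ k j)))
                              (ℚP.*-comm (ℕ→ℚ (x k)) (Φ k i ℚ.* Φ k j)))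

  integrable : Integrable s G
  integrable = ℕΣ.sum x , v , v·v≡sG

lemma7p4 : (s : ℕ) → NonZero s → (n : ℕ) → (G : Gram n) → IsLattice G →
           (N : ℕ) → (us : VecList N n) → EnumeratesDualBall G s N us →
           (Integrable s G ⇔ SystemSolvable G s N us)
-- The argument never uses s ≠ 0.
lemma7p4 s _ n G lat N us enum@(us∈ball , _ , _) = mk⇔
  (λ { (m , v , v·v≡sG) → Integrable⇒Solvable.solvable s lat v v·v≡sG us enum })
  (λ sol → Solvable⇒Integrable.integrable s lat us (proj₁ ∘ us∈ball) sol)
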